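{- Let $k\ge3$ and $q=q_1q_2$ with integers $q_1\ge3$ and $q_2\ge2$, and suppose that either $q_2\ge3$, or $q_2=2$ and $k$ is odd. Then there exists a $k$-ary commutative uniquely extendable constraint $\psi$ on a spin set $\Omega$ of size $q$ that is not equivalent to any group constraint function, i.e. there is no group operation $+$ on $\Omega$ and no $b\in\Omega$ such that $\psi=\psi_{(\Omega,+),b}$.
   Context: A $k$-ary constraint on a set $\Omega$ is a map $\psi:\Omega^k\to\{0,1\}$; write $\sigma\models\psi$ if $\psi(\sigma)=1$. $\psi$ is uniquely extendable if for every $i\in[k]$ and every assignment of the other $k-1$ coordinates there is a unique element in coordinate $i$ making the tuple satisfy $\psi$; it is commutative if $\sigma\models\psi\iff(\sigma_{\pi(1)},\dots,\sigma_{\pi(k)})\models\psi$ for all $\sigma\in\Omega^k$ and permutations $\pi$ of $[k]$. For a (not necessarily abelian) group $(\Omega,+)$ and $b\in\Omega$, $\psi_{(\Omega,+),b}$ is the constraint with $(\sigma_1,\dots,\sigma_k)\models\psi_{(\Omega,+),b}$ iff $\sigma_1+\cdots+\sigma_k=b$. -}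

module Defs where

open import Data.Nat using (ℕ; zero; suc) renaming (_*_ to _*ℕ_)
open import Data.Fin using (Fin)
open import Data.Bool using (Bool; true)
open import Data.Product using (∃!; Σ; _×_; ∃)
open import Data.Vec.Functional using (Vector; updateAt; foldl)
open import Data.Fin.Permutation using (Permutation′; _⟨$⟩ʳ_)
open import Function using (_∘_; const)
open import Relation.Binary.PropositionalEquality using (_≡_)

Constraint : Set → ℕ → Set
Constraint Ω k = Vector Ω k → Bool

_⊨_ : ∀ {Ω : Set} {k} → Vector Ω k → Constraint Ω k → Set
σ ⊨ ψ = ψ σ ≡ true

_[_≔_] : ∀ {Ω : Set} {k} → Vector Ω k → Fin k → Ω → Vector Ω k
σ [ i ≔ x ] = updateAt σ i (λ _ → x)

-- uniquely extendable: for each coordinate i and each assignment of the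
-- other coordinates (given by σ; coordinate i of σ is ignored) there is a
-- unique value at i satisfying ψ
UniquelyExtendable : ∀ {Ω : Set} {k} → Constraint Ω k → Set
UniquelyExtendable {Ω} {k} ψ =
  (i : Fin k) (σ : Vector Ω k) → ∃! _≡_ (λ x → (σ [ i ≔ x ]) ⊨ ψ)

Commutative : ∀ {Ω : Set} {k} → Constraint Ω k → Set
Commutative {Ω} {k} ψ =
  (π : Permutation′ k) (σ : Vector Ω k) →
  (σ ⊨ ψ → (σ ∘ (π ⟨$⟩ʳ_)) ⊨ ψ) × ((σ ∘ (π ⟨$⟩ʳ_)) ⊨ ψ → σ ⊨ ψ)

record GroupOn (Ω : Set) : Set where
  field
    _+_   : Ω → Ω → Ω
    0g    : Ω
    -_    : Ω → Ω
    assoc : ∀ x y z → (x + y) + z ≡ x + (y + z)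
    idˡ   : ∀ x → 0g + x ≡ x
    idʳ   : ∀ x → x + 0g ≡ x
    invˡ  : ∀ x → (- x) + x ≡ 0g
    invʳ  : ∀ x → x + (- x) ≡ 0g

groupSum : ∀ {Ω : Set} {k} → GroupOn Ω → Vector Ω k → Ω
groupSum G σ = foldl _+_ 0g σ
  where open GroupOn G

GroupConstraintIs : ∀ {Ω : Set} {k} → GroupOn Ω → Ω → Constraint Ω k → Set
GroupConstraintIs {Ω} {k} G b ψ =
  (σ : Vector Ω k) → (σ ⊨ ψ → groupSum G σ ≡ b) × (groupSum G σ ≡ b → σ ⊨ ψ)

IsOdd : ℕ → Set
IsOdd k = ∃ λ m → k ≡ suc (2 *ℕ m)

{-# OPTIONS --safe #-}
-- Take Ω = ℤ/N with N = q₁q₂ and let σ ⊨ ψ iff σ₁ + ⋯ + σₖ ≡ q₁·[at least two σᵢ ≡ 1 (mod q₁)]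
-- (mod N). It is uniquely extendable: the right-hand side is 0 modulo q₁, so
-- a missing coordinate is first determined modulo q₁; that fixes the right-hand side, and hence
-- the coordinate modulo N. It is not a group constraint: in a group constraint, if (x, y, z, 0, …)
-- and (x′, y′, z, 0, …) are both satisfied then x + y = x′ + y′. Five satisfied triples built
-- from 0, 1, 2 and −1 force 2 + 0 = 1 + 1 in the group, so (2, 0, q₁ − 2) would be satisfied
-- along with (1, 1, q₁ − 2); but both have sum q₁, and only the second has two coordinates ≡ 1.
module Submission where

open import Defs
open import Algebra.Bundles using (Group)
import Algebra.Properties.Group as GroupProperties
open import Data.Bool.Properties using (T-≡)
open import Data.Fin using (Fin; zero; suc; toℕ; fromℕ; fromℕ<)
open import Data.Fin.Properties using (toℕ-fromℕ; toℕ-fromℕ<; toℕ<n; toℕ-injective)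
open import Data.Fin.Permutation using (Permutation′; _⟨$⟩ʳ_)
open import Data.Nat using (ℕ; zero; suc; pred; _∸_; _+_; _*_; _%_; _≡ᵇ_; _≤_; _<_; s≤s; z≤n; z<s; NonZero)
open import Data.Nat.Properties
open import Data.Nat.DivMod
open import Data.Nat.Divisibility using (_∣_; _∣0; ∣-refl; ∣-trans; m∣m*n; n∣m⇒m%n≡0)
open import Algebra.Properties.CommutativeMonoid.Sum +-0-commutativeMonoid
  using (sum; sum-permute; sum-cong-≗; sum-replicate-zero)
open import Algebra.Properties.CommutativeSemigroup +-commutativeSemigroup using (x∙yz≈y∙xz)
open import Data.Product using (Σ; _×_; _,_; proj₁; proj₂; ∃!)
open import Data.Sum using (_⊎_)
open import Data.Vec.Functional using (Vector; foldl; _∷_; replicate; removeAt; tail)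
open import Function using (_∘_)
open import Function.Bundles using (_⇔_; mk⇔)
open Function.Bundles.Equivalence using (to; from)
open import Level using (0ℓ)
open import Relation.Nullary using (¬_)
open import Relation.Binary.PropositionalEquality
  using (_≡_; refl; sym; trans; cong; cong₂; subst₂; isEquivalence; module ≡-Reasoning)

[m%d+n]%d≡[m+n]%d : ∀ m n d .{{_ : NonZero d}} → (m % d + n) % d ≡ (m + n) % d
[m%d+n]%d≡[m+n]%d m n d = begin
  (m % d + n) % d         ≡⟨ %-distribˡ-+ (m % d) n d ⟩
  (m % d % d + n % d) % d ≡⟨ cong (λ r → (r + n % d) % d) (m%n%n≡m%n m d) ⟩
  (m % d + n % d) % d     ≡⟨ %-distribˡ-+ m n d ⟨
  (m + n) % d             ∎
  where open ≡-Reasoning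

A+pred[N]*A≡N*A : ∀ N .{{_ : NonZero N}} A → A + pred N * A ≡ N * A
A+pred[N]*A≡N*A N A = cong (_* A) (suc-pred N)

x%d≡[[x+A]%d+pred[N]*A]%d : ∀ {d N} .{{_ : NonZero d}} .{{_ : NonZero N}} → d ∣ N →
  ∀ x A → x % d ≡ ((x + A) % d + pred N * A) % d
x%d≡[[x+A]%d+pred[N]*A]%d {d} {N} d∣N x A = begin
  x % d                           ≡⟨ %-remove-+ʳ x (∣-trans d∣N (m∣m*n A)) ⟨
  (x + N * A) % d                 ≡⟨ cong (λ n → (x + n) % d) (A+pred[N]*A≡N*A N A) ⟨
  (x + (A + pred N * A)) % d      ≡⟨ cong (_% d) (+-assoc x A _) ⟨
  (x + A + pred N * A) % d        ≡⟨ [m%d+n]%d≡[m+n]%d (x + A) _ d ⟨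
  ((x + A) % d + pred N * A) % d  ∎
  where open ≡-Reasoning

[[t+pred[N]*A]%N+A]%N≡t%N : ∀ N .{{_ : NonZero N}} t A → ((t + pred N * A) % N + A) % N ≡ t % N
[[t+pred[N]*A]%N+A]%N≡t%N N t A = begin
  ((t + pred N * A) % N + A) % N ≡⟨ [m%d+n]%d≡[m+n]%d (t + pred N * A) A N ⟩
  (t + pred N * A + A) % N       ≡⟨ cong (_% N) (+-assoc t _ A) ⟩
  (t + (pred N * A + A)) % N     ≡⟨ cong (λ n → (t + n) % N) (trans (+-comm _ A) (A+pred[N]*A≡N*A N A)) ⟩
  (t + N * A) % N                ≡⟨ %-remove-+ʳ t (m∣m*n A) ⟩
  t % N                          ∎
  where open ≡-Reasoning

∃!-mod-solution : ∀ {N d} .{{_ : NonZero N}} .{{_ : NonZero d}} → d ∣ N →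
  (h : ℕ → ℕ) → (∀ r → d ∣ h r) → (∀ r → h r < N) →
  ∀ A → ∃! _≡_ λ (x : Fin N) → (toℕ x + A) % N ≡ h (toℕ x % d)
∃!-mod-solution {N} {d} d∣N h d∣h h<N A = x₀ , x₀-solves , x₀-unique
  where
  open ≡-Reasoning

  Solves : Fin N → Set
  Solves x = (toℕ x + A) % N ≡ h (toℕ x % d)

  r₀ t : ℕ
  r₀ = pred N * A % d
  t = h r₀

  residue : ∀ {x} → Solves x → toℕ x % d ≡ r₀
  residue {x} solves = begin
    toℕ x % d                          ≡⟨ x%d≡[[x+A]%d+pred[N]*A]%d d∣N (toℕ x) A ⟩
    ((toℕ x + A) % d + pred N * A) % d ≡⟨ cong (λ r → (r + pred N * A) % d) [x+A]%d≡0 ⟩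
    r₀                                 ∎
    where
    [x+A]%d≡0 : (toℕ x + A) % d ≡ 0
    [x+A]%d≡0 = begin
      (toℕ x + A) % d     ≡⟨ m∣n⇒o%n%m≡o%m d N _ d∣N ⟨
      (toℕ x + A) % N % d ≡⟨ cong (_% d) solves ⟩
      h (toℕ x % d) % d   ≡⟨ n∣m⇒m%n≡0 _ d (d∣h _) ⟩
      0                   ∎

  x₀ : Fin N
  x₀ = fromℕ< (m%n<n (t + pred N * A) N)

  x₀-residue : toℕ x₀ % d ≡ r₀
  x₀-residue = begin
    toℕ x₀ % d                 ≡⟨ cong (_% d) (toℕ-fromℕ< _) ⟩
    (t + pred N * A) % N % d   ≡⟨ m∣n⇒o%n%m≡o%m d N _ d∣N ⟩
    (t + pred N * A) % d       ≡⟨ %-remove-+ˡ _ (d∣h r₀) ⟩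
    r₀                         ∎

  x₀-solves : Solves x₀
  x₀-solves = begin
    (toℕ x₀ + A) % N                ≡⟨ cong (λ n → (n + A) % N) (toℕ-fromℕ< _) ⟩
    ((t + pred N * A) % N + A) % N  ≡⟨ [[t+pred[N]*A]%N+A]%N≡t%N N t A ⟩
    t % N                           ≡⟨ m<n⇒m%n≡m (h<N r₀) ⟩
    t                               ≡⟨ cong h x₀-residue ⟨
    h (toℕ x₀ % d)                  ∎

  -- A solution determines its residue mod d, hence the target t, hence itself mod N.
  on-target : ∀ {x} → Solves x → (toℕ x + A) % N ≡ t
  on-target solves = trans solves (cong h (residue solves))

  x₀-unique : ∀ {y} → Solves y → x₀ ≡ y
  x₀-unique {y} solves = toℕ-injective (begin
    toℕ x₀                               ≡⟨ m<n⇒m%n≡m (toℕ<n x₀) ⟨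
    toℕ x₀ % N                           ≡⟨ x%d≡[[x+A]%d+pred[N]*A]%d ∣-refl (toℕ x₀) A ⟩
    ((toℕ x₀ + A) % N + pred N * A) % N  ≡⟨ cong (λ r → (r + pred N * A) % N) x₀-on-y's-target ⟩
    ((toℕ y + A) % N + pred N * A) % N   ≡⟨ x%d≡[[x+A]%d+pred[N]*A]%d ∣-refl (toℕ y) A ⟨
    toℕ y % N                            ≡⟨ m<n⇒m%n≡m (toℕ<n y) ⟩
    toℕ y                                ∎)
    where
    x₀-on-y's-target : (toℕ x₀ + A) % N ≡ (toℕ y + A) % N
    x₀-on-y's-target = trans (on-target x₀-solves) (sym (on-target solves))

sum-updateAt : ∀ {A : Set} {n} (f : A → ℕ) (σ : Vector A (suc n)) i x →
  sum (f ∘ (σ [ i ≔ x ])) ≡ f x + sum (f ∘ removeAt σ i)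
sum-updateAt f σ zero x = refl
sum-updateAt {n = suc n} f σ (suc i) x = begin
  f (σ zero) + sum (f ∘ (tail σ [ i ≔ x ]))           ≡⟨ cong (f (σ zero) +_) (sum-updateAt f (tail σ) i x) ⟩
  f (σ zero) + (f x + sum (f ∘ removeAt (tail σ) i))  ≡⟨ x∙yz≈y∙xz (f (σ zero)) (f x) _ ⟩
  f x + (f (σ zero) + sum (f ∘ removeAt (tail σ) i))  ∎
  where open ≡-Reasoning

module _ {c ℓ} (G : Group c ℓ) where
  open Group G
  open GroupProperties G using (∙-cancelʳ; \\-leftDividesʳ; //-rightDividesˡ)
  open import Relation.Binary.Reasoning.Setoid setoid

  xx≈yw⇒xy≈yx⇒yx≈zw⇒zx≈yy : ∀ {x y z w} →
    x ∙ x ≈ y ∙ w → x ∙ y ≈ y ∙ x → y ∙ x ≈ z ∙ w → z ∙ x ≈ y ∙ y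
  xx≈yw⇒xy≈yx⇒yx≈zw⇒zx≈yy {x} {y} {z} {w} xx≈yw xy≈yx yx≈zw = begin
    z ∙ x                ≈⟨ ∙-congʳ (//-rightDividesˡ y z) ⟨
    (z // y) ∙ y ∙ x     ≈⟨ assoc _ y x ⟩
    (z // y) ∙ (y ∙ x)   ≈⟨ ∙-congˡ xy≈yx ⟨
    (z // y) ∙ (x ∙ y)   ≈⟨ assoc _ x y ⟨
    (z // y) ∙ x ∙ y     ≈⟨ ∙-congʳ z//y∙x≈y ⟩
    y ∙ y                ∎
    where
    z//y∙x≈y : (z // y) ∙ x ≈ y
    z//y∙x≈y = ∙-cancelʳ x _ _ (begin
      (z // y) ∙ x ∙ x     ≈⟨ assoc _ x x ⟩
      (z // y) ∙ (x ∙ x)   ≈⟨ ∙-congˡ xx≈yw ⟩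
      (z // y) ∙ (y ∙ w)   ≈⟨ assoc z (y ⁻¹) (y ∙ w) ⟩
      z ∙ (y \\ y ∙ w)     ≈⟨ ∙-congˡ (\\-leftDividesʳ y w) ⟩
      z ∙ w                ≈⟨ yx≈zw ⟨
      y ∙ x                ∎)

toGroup : ∀ {Ω} → GroupOn Ω → Group 0ℓ 0ℓ
toGroup {Ω} G = record
  { Carrier = Ω ; _≈_ = _≡_ ; _∙_ = _∙_ ; ε = 0g ; _⁻¹ = -_
  ; isGroup = record
    { isMonoid = record
      { isSemigroup = record
        { isMagma = record { isEquivalence = isEquivalence ; ∙-cong = cong₂ _∙_ }
        ; assoc = assoc
        }
      ; identity = idˡ , idʳ
      }
    ; inverse = invˡ , invʳ
    ; ⁻¹-cong = cong -_
    }
  }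
  where open GroupOn G renaming (_+_ to _∙_)

module _ {Ω : Set} (G : GroupOn Ω) where
  open GroupOn G renaming (_+_ to _∙_)
  open ≡-Reasoning

  foldl-∙-assoc : ∀ {n} x y (τ : Vector Ω n) → foldl _∙_ (x ∙ y) τ ≡ x ∙ foldl _∙_ y τ
  foldl-∙-assoc {zero}  x y τ = refl
  foldl-∙-assoc {suc n} x y τ = begin
    foldl _∙_ ((x ∙ y) ∙ τ zero) (tail τ)  ≡⟨ cong (λ u → foldl _∙_ u (tail τ)) (assoc x y (τ zero)) ⟩
    foldl _∙_ (x ∙ (y ∙ τ zero)) (tail τ)  ≡⟨ foldl-∙-assoc x (y ∙ τ zero) (tail τ) ⟩
    x ∙ foldl _∙_ (y ∙ τ zero) (tail τ)    ∎

  foldl≡∙groupSum : ∀ {n} x (τ : Vector Ω n) → foldl _∙_ x τ ≡ x ∙ groupSum G τ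
  foldl≡∙groupSum x τ = trans (cong (λ u → foldl _∙_ u τ) (sym (idʳ x))) (foldl-∙-assoc x 0g τ)

  groupSum-∷∷ : ∀ {n} x y (τ : Vector Ω n) → groupSum G (x ∷ y ∷ τ) ≡ (x ∙ y) ∙ groupSum G τ
  groupSum-∷∷ x y τ = trans (cong (λ u → foldl _∙_ (u ∙ y) τ) (idˡ x)) (foldl≡∙groupSum (x ∙ y) τ)

  module _ {n b} {φ : Constraint Ω (2 + n)} (φ≡G : GroupConstraintIs G b φ) where
    ⊨-∷∷⇔ : ∀ x y τ → (x ∷ y ∷ τ) ⊨ φ ⇔ (x ∙ y) ∙ groupSum G τ ≡ b
    ⊨-∷∷⇔ x y τ = mk⇔ (trans (sym (groupSum-∷∷ x y τ)) ∘ proj₁ (φ≡G _))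
                      (proj₂ (φ≡G _) ∘ trans (groupSum-∷∷ x y τ))

    ⊨-∷∷⇒∙≡ : ∀ {x y x′ y′} τ → (x ∷ y ∷ τ) ⊨ φ → (x′ ∷ y′ ∷ τ) ⊨ φ → x ∙ y ≡ x′ ∙ y′
    ⊨-∷∷⇒∙≡ {x} {y} {x′} {y′} τ ⊨xy ⊨x′y′ = ∙-cancelʳ (groupSum G τ) _ _
      (trans (to (⊨-∷∷⇔ x y τ) ⊨xy) (sym (to (⊨-∷∷⇔ x′ y′ τ) ⊨x′y′)))
      where open GroupProperties (toGroup G) using (∙-cancelʳ)

    ∙≡⇒⊨-∷∷ : ∀ {x y x′ y′} τ → x ∙ y ≡ x′ ∙ y′ → (x ∷ y ∷ τ) ⊨ φ → (x′ ∷ y′ ∷ τ) ⊨ φ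
    ∙≡⇒⊨-∷∷ {x} {y} {x′} {y′} τ xy≡x′y′ ⊨xy = from (⊨-∷∷⇔ x′ y′ τ)
      (trans (cong (_∙ groupSum G τ) (sym xy≡x′y′)) (to (⊨-∷∷⇔ x y τ) ⊨xy))

module Construction (q₁-3 q₂-2 : ℕ) where
  q₁ q₂ N : ℕ
  q₁ = 3 + q₁-3
  q₂ = 2 + q₂-2
  N = q₁ * q₂

  Ω : Set
  Ω = Fin N

  isOne : ℕ → ℕ
  isOne 1 = 1
  isOne _ = 0

  offset : ℕ → ℕ
  offset (suc (suc _)) = q₁
  offset _             = 0

  mark : Ω → ℕ
  mark x = isOne (toℕ x % q₁)

  ψ : ∀ {k} → Constraint Ω k
  ψ σ = sum (toℕ ∘ σ) % N ≡ᵇ offset (sum (mark ∘ σ))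

  ⊨ψ⇔ : ∀ {k} (σ : Vector Ω k) → σ ⊨ ψ ⇔ sum (toℕ ∘ σ) % N ≡ offset (sum (mark ∘ σ))
  ⊨ψ⇔ σ = mk⇔ (≡ᵇ⇒≡ _ _ ∘ from T-≡) (to T-≡ ∘ ≡⇒≡ᵇ _ _)

  ψ-permute : ∀ {k} (π : Permutation′ k) (σ : Vector Ω k) → ψ (σ ∘ (π ⟨$⟩ʳ_)) ≡ ψ σ
  ψ-permute π σ = cong₂ (λ s c → s % N ≡ᵇ offset c)
    (sym (sum-permute (toℕ ∘ σ) π)) (sym (sum-permute (mark ∘ σ) π))

  ψ-commutative : ∀ {k} → Commutative (ψ {k})
  ψ-commutative π σ = trans (ψ-permute π σ) , trans (sym (ψ-permute π σ))

  q₁<N : q₁ < N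
  q₁<N = m<m*n q₁ q₂ (s≤s (s≤s z≤n))

  q₁∣offset : ∀ n → q₁ ∣ offset n
  q₁∣offset zero          = q₁ ∣0
  q₁∣offset (suc zero)    = q₁ ∣0
  q₁∣offset (suc (suc _)) = ∣-refl

  offset<N : ∀ n → offset n < N
  offset<N zero          = z<s
  offset<N (suc zero)    = z<s
  offset<N (suc (suc _)) = q₁<N

  ⊨-updateAt : ∀ {k} (σ : Vector Ω (suc k)) i x → (σ [ i ≔ x ]) ⊨ ψ ⇔
    (toℕ x + sum (toℕ ∘ removeAt σ i)) % N ≡ offset (mark x + sum (mark ∘ removeAt σ i))
  ⊨-updateAt σ i x = subst₂ (λ s c → (σ [ i ≔ x ]) ⊨ ψ ⇔ s % N ≡ offset c)
    (sum-updateAt toℕ σ i x) (sum-updateAt mark σ i x) (⊨ψ⇔ (σ [ i ≔ x ]))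

  ψ-uniquelyExtendable : ∀ {k} → UniquelyExtendable (ψ {suc k})
  ψ-uniquelyExtendable i σ =
    let x , solves , unique = ∃!-mod-solution (m∣m*n q₂) (offset ∘ count) (q₁∣offset ∘ count) (offset<N ∘ count) A
    in  x , from (⊨-updateAt σ i x) solves , λ {y} → unique ∘ to (⊨-updateAt σ i y)
    where
    A D : ℕ
    A = sum (toℕ ∘ removeAt σ i)
    D = sum (mark ∘ removeAt σ i)

    count : ℕ → ℕ
    count r = isOne r + D

  N-1 : ℕ
  N-1 = pred N

  [N-1]%q₁ : N-1 % q₁ ≡ q₁ ∸ 1
  [N-1]%q₁ = %-pred-≡0 {N-1} (n∣m⇒m%n≡0 N q₁ (m∣m*n q₂))

  offset-isOne : ∀ r → offset (isOne r) ≡ 0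
  offset-isOne zero          = refl
  offset-isOne (suc zero)    = refl
  offset-isOne (suc (suc _)) = refl

  Sat : ℕ → ℕ → ℕ → Set
  Sat i j l = (i + (j + l)) % N ≡ offset (isOne (i % q₁) + (isOne (j % q₁) + isOne (l % q₁)))

  sat-0-0-0 : Sat 0 0 0
  sat-0-0-0 = refl

  sat-1-[N-1]-0 : Sat 1 N-1 0
  sat-1-[N-1]-0 = begin
    (1 + (N-1 + 0)) % N                  ≡⟨ cong (λ n → suc n % N) (+-identityʳ N-1) ⟩
    N % N                                ≡⟨ n%n≡0 N ⟩
    0                                    ≡⟨ cong (λ r → offset (1 + (isOne r + 0))) [N-1]%q₁ ⟨
    offset (1 + (isOne (N-1 % q₁) + 0))  ∎
    where open ≡-Reasoning

  sat-0-1-[N-1] : Sat 0 1 N-1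
  sat-0-1-[N-1] = trans (n%n≡0 N) (sym (cong (λ r → offset (1 + isOne r)) [N-1]%q₁))

  sat-1-0-[N-1] : Sat 1 0 N-1
  sat-1-0-[N-1] = trans (n%n≡0 N) (sym (cong (λ r → offset (1 + isOne r)) [N-1]%q₁))

  sat-2-[N-1]-[N-1] : Sat 2 N-1 N-1
  sat-2-[N-1]-[N-1] = begin
    (2 + (N-1 + N-1)) % N                         ≡⟨ cong (λ n → suc n % N) (+-suc N-1 N-1) ⟨
    (N + N) % N                                   ≡⟨ [m+n]%n≡m%n N N ⟩
    N % N                                         ≡⟨ n%n≡0 N ⟩
    0                                             ≡⟨ cong (λ r → offset (isOne r + isOne r)) [N-1]%q₁ ⟨
    offset (isOne (N-1 % q₁) + isOne (N-1 % q₁))  ∎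
    where open ≡-Reasoning

  sat-1-1-[q₁-2] : Sat 1 1 (q₁ ∸ 2)
  sat-1-1-[q₁-2] = m<n⇒m%n≡m q₁<N

  ¬sat-2-0-[q₁-2] : ¬ Sat 2 0 (q₁ ∸ 2)
  ¬sat-2-0-[q₁-2] sat = 1+n≢0 (begin
    q₁                              ≡⟨ m<n⇒m%n≡m q₁<N ⟨
    q₁ % N                          ≡⟨ sat ⟩
    offset (isOne ((q₁ ∸ 2) % q₁))  ≡⟨ offset-isOne ((q₁ ∸ 2) % q₁) ⟩
    0                               ∎)
    where open ≡-Reasoning

  2<N : 2 < N
  2<N = ≤-<-trans (m≤m+n 2 (q₁ ∸ 2)) q₁<N

  [q₁-2]<N : q₁ ∸ 2 < N
  [q₁-2]<N = ≤-<-trans (m≤n+m (q₁ ∸ 2) 2) q₁<N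

  one two minus-one q₁-2 : Ω
  one       = suc zero
  two       = fromℕ< 2<N
  minus-one = fromℕ N-1
  q₁-2      = fromℕ< [q₁-2]<N

  module _ (m : ℕ) where
    zeros : Vector Ω m
    zeros = replicate m zero

    pad : Ω → Ω → Ω → Vector Ω (3 + m)
    pad x y z = x ∷ y ∷ z ∷ zeros

    sum-pad : (f : Ω → ℕ) → f zero ≡ 0 → ∀ x y z → sum (f ∘ pad x y z) ≡ f x + (f y + f z)
    sum-pad f f0≡0 x y z = cong (λ n → f x + (f y + n)) (begin
      f z + sum (f ∘ zeros)      ≡⟨ cong (f z +_) (sum-cong-≗ {m} (λ _ → f0≡0)) ⟩
      f z + sum (replicate m 0)  ≡⟨ cong (f z +_) (sum-replicate-zero m) ⟩
      f z + 0                    ≡⟨ +-identityʳ (f z) ⟩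
      f z                        ∎)
      where open ≡-Reasoning

    ⊨-pad : ∀ x y z {i j l} → toℕ x ≡ i → toℕ y ≡ j → toℕ z ≡ l → pad x y z ⊨ ψ ⇔ Sat i j l
    ⊨-pad x y z refl refl refl = subst₂ (λ s c → pad x y z ⊨ ψ ⇔ s % N ≡ offset c)
      (sum-pad toℕ refl x y z) (sum-pad mark refl x y z) (⊨ψ⇔ (pad x y z))

    ψ-notGroup : ¬ Σ (GroupOn Ω) λ G → Σ Ω λ b → GroupConstraintIs G b (ψ {3 + m})
    ψ-notGroup (G , b , ψ≡G) = ¬sat-2-0-[q₁-2] (to (⊨-pad two zero q₁-2 toℕ-two refl toℕ-q₁-2)
      (∙≡⇒⊨-∷∷ G ψ≡G (q₁-2 ∷ zeros) 1∙1≡2∙0 (sat⇒⊨ one one q₁-2 refl refl toℕ-q₁-2 sat-1-1-[q₁-2])))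
      where
      open GroupOn G renaming (_+_ to _∙_)

      sat⇒⊨ : ∀ x y z {i j l} → toℕ x ≡ i → toℕ y ≡ j → toℕ z ≡ l → Sat i j l → pad x y z ⊨ ψ
      sat⇒⊨ x y z ex ey ez = from (⊨-pad x y z ex ey ez)

      toℕ-two : toℕ two ≡ 2
      toℕ-two = toℕ-fromℕ< 2<N

      toℕ-q₁-2 : toℕ q₁-2 ≡ q₁ ∸ 2
      toℕ-q₁-2 = toℕ-fromℕ< [q₁-2]<N

      toℕ-minus-one : toℕ minus-one ≡ N-1
      toℕ-minus-one = toℕ-fromℕ N-1

      0∙0≡1∙[-1] : zero ∙ zero ≡ one ∙ minus-one
      0∙0≡1∙[-1] = ⊨-∷∷⇒∙≡ G ψ≡G (zero ∷ zeros)
        (sat⇒⊨ zero zero zero refl refl refl sat-0-0-0)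
        (sat⇒⊨ one minus-one zero refl toℕ-minus-one refl sat-1-[N-1]-0)

      0∙1≡1∙0 : zero ∙ one ≡ one ∙ zero
      0∙1≡1∙0 = ⊨-∷∷⇒∙≡ G ψ≡G (minus-one ∷ zeros)
        (sat⇒⊨ zero one minus-one refl refl toℕ-minus-one sat-0-1-[N-1])
        (sat⇒⊨ one zero minus-one refl refl toℕ-minus-one sat-1-0-[N-1])

      1∙0≡2∙[-1] : one ∙ zero ≡ two ∙ minus-one
      1∙0≡2∙[-1] = ⊨-∷∷⇒∙≡ G ψ≡G (minus-one ∷ zeros)
        (sat⇒⊨ one zero minus-one refl refl toℕ-minus-one sat-1-0-[N-1])
        (sat⇒⊨ two minus-one minus-one toℕ-two toℕ-minus-one toℕ-minus-one sat-2-[N-1]-[N-1])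

      1∙1≡2∙0 : one ∙ one ≡ two ∙ zero
      1∙1≡2∙0 = sym (xx≈yw⇒xy≈yx⇒yx≈zw⇒zx≈yy (toGroup G) 0∙0≡1∙[-1] 0∙1≡1∙0 1∙0≡2∙[-1])

theorem5p3 : (k q₁ q₂ : ℕ) → 3 ≤ k → 3 ≤ q₁ → 2 ≤ q₂ →
    (3 ≤ q₂ ⊎ (q₂ ≡ 2 × IsOdd k)) →
    Σ (Constraint (Fin (q₁ * q₂)) k) λ ψ →
      Commutative ψ × UniquelyExtendable ψ ×
      ¬ (Σ (GroupOn (Fin (q₁ * q₂))) λ G → Σ (Fin (q₁ * q₂)) λ b →
           GroupConstraintIs G b ψ)
theorem5p3 _ _ _ (s≤s (s≤s (s≤s (z≤n {n = m})))) (s≤s (s≤s (s≤s (z≤n {n = q₁-3})))) (s≤s (s≤s (z≤n {n = q₂-2}))) _ =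
  ψ , ψ-commutative , ψ-uniquelyExtendable , ψ-notGroup m
  where open Construction q₁-3 q₂-2
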